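{- $\zeta(C_5 \square C_3) = 2$, where $C_5$ and $C_3$ are the cycles on five and three vertices.
   Context: The localization game on a connected graph $G$ is played by a Cop controlling $k$ cops and a Robber. The Robber first chooses a vertex $r$, unknown to the Cop. In each turn the Cop probes a set $B=\{b_1,\dots,b_k\}$ of $k$ vertices and receives the distance vector $[d_G(r,b_1),\dots,d_G(r,b_k)]$. If the Cop can determine $r$ exactly, the Cop wins; otherwise the Robber may stay at $r$ or move to a neighbour of $r$, and the next turn begins. The Cop wins if the Robber is located after finitely many turns. The localization number $\zeta(G)$ is the least positive integer $k$ such that the Cop has a winning strategy with $k$ cops. $\square$ denotes the Cartesian product of graphs. -}

module Defs where

open import Data.Nat using (ℕ; zero; suc; _≡ᵇ_; _%_; NonZero; _≤_; _<_)
open import Data.Bool using (Bool; true; false; _∨_; _∧_; if_then_else_)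
open import Data.Fin using (Fin; toℕ)
import Data.Fin.Properties as FinP
open import Data.Bool.ListAction using (any)
open import Data.List using (List; []; _∷_; length; cartesianProduct; allFin)
open import Data.Vec using (Vec)
import Data.Vec as Vec
open import Data.Product using (Σ; ∃; _×_; _,_)
import Data.Product.Properties as ProdP
open import Data.Sum using (_⊎_)
open import Relation.Binary.Definitions using (DecidableEquality)
open import Relation.Binary.PropositionalEquality using (_≡_)
open import Relation.Nullary using (¬_; does)

record Graph : Set₁ where
  field
    V        : Set
    _≟_      : DecidableEquality V
    vertices : List V
    adj      : V → V → Bool
open Graph public

Within : (G : Graph) → ℕ → V G → V G → Bool
Within G zero    u v = does (_≟_ G u v)
Within G (suc m) u v =
  Within G m u v ∨ any (λ w → adj G u w ∧ Within G m w v) (vertices G)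

-- Shortest-path distance d_G(u,v): least m with a walk of length ≤ m
-- (searched up to |V(G)|, which suffices in a connected graph).
dist : (G : Graph) → V G → V G → ℕ
dist G u v = search 0 (length (vertices G))
  where
  search : ℕ → ℕ → ℕ
  search m zero    = m
  search m (suc f) = if Within G m u v then m else search (suc m) f

Cycle : (m : ℕ) → .{{NonZero m}} → Graph
Cycle m = record
  { V = Fin m
  ; _≟_ = FinP._≟_
  ; vertices = allFin m
  ; adj = λ i j → (toℕ j ≡ᵇ (suc (toℕ i) % m)) ∨ (toℕ i ≡ᵇ (suc (toℕ j) % m))
  }

_□_ : Graph → Graph → Graph
G □ H = record
  { V = V G × V H
  ; _≟_ = ProdP.≡-dec (_≟_ G) (_≟_ H)
  ; vertices = cartesianProduct (vertices G) (vertices H)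
  ; adj = λ { (g , h) (g' , h') →
        (does (_≟_ G g g') ∧ adj H h h') ∨ (adj G g g' ∧ does (_≟_ H h h')) }
  }

-- A Cop strategy: given the history of distance vectors received so far
-- (most recent first), choose the next probe (k vertices).
Strategy : Graph → ℕ → Set
Strategy G k = List (Vec ℕ k) → Vec (V G) k

-- A Robber play: an infinite sequence of positions, each step staying
-- put or moving to a neighbour.  (The Cop is deterministic, so an
-- adaptive Robber is no stronger than one fixing its walk in advance.)
IsWalk : (G : Graph) → (ℕ → V G) → Set
IsWalk G w = ∀ i → w (suc i) ≡ w i ⊎ adj G (w i) (w (suc i)) ≡ true

history : (G : Graph) {k : ℕ} → Strategy G k → (ℕ → V G) → ℕ → List (Vec ℕ k)
history G σ w zero    = []
history G σ w (suc t) =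
  let h = history G σ w t in Vec.map (dist G (w t)) (σ h) ∷ h

-- After the probe of turn t the Cop determines the Robber's position:
-- every Robber play producing the same responses in turns 0,…,t is at
-- the same vertex at turn t.
Located : (G : Graph) {k : ℕ} → Strategy G k → (ℕ → V G) → ℕ → Set
Located G σ w t = ∀ w' → IsWalk G w' →
  history G σ w' (suc t) ≡ history G σ w (suc t) → w' t ≡ w t

CopWins : Graph → ℕ → Set
CopWins G k = Σ (Strategy G k) λ σ →
  ∀ w → IsWalk G w → ∃ λ t → Located G σ w t

LocalizationNumberIs : Graph → ℕ → Set
LocalizationNumberIs G k =
  1 ≤ k × CopWins G k × (∀ j → 1 ≤ j → j < k → ¬ CopWins G j)

-- Two cops: the answers to the probe (0,0), (0,1) determine the robber's vertex (i , j) up to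
-- the reflection i ↦ −i of C₅.  When they do not, a second probe chosen from these answers
-- separates all vertices the robber can have reached in one move from either candidate.
-- One cop: the robber runs a second, shadow walk that stays at distance 1 or 2 from its own and
-- gets the same answer to every probe.  Some such pair answers the first probe alike, and from
-- any such pair both walks can step to a new such pair answering the next probe alike.
-- The finite facts about C₅ □ C₃ are decided by evaluation.
module Submission where

open import Data.Bool using (true)
import Data.Bool.Properties as Bool
open import Data.Fin using (Fin; toℕ; #_)
open import Data.Fin.Properties using (all?; any?)
open import Data.List using (List; []; _∷_; length)
open import Data.List.Properties using (∷-injective; ∷-injectiveˡ)
open import Data.Nat using (ℕ; zero; suc; _+_; _∸_; _⊓_; ∣_-_∣; _≤_; _<_; _≤?_; _<?_; s≤s; z≤n)
import Data.Nat.Properties as ℕ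
open import Data.Product using (Σ; ∃; ∃₂; _×_; _,_; proj₁)
open import Data.Sum using (_⊎_; inj₁; inj₂)
open import Data.Vec using (Vec; []; _∷_)
import Data.Vec as Vec
import Data.Vec.Properties as Vec
open import Function using (_∘_)
open import Relation.Binary.PropositionalEquality using (_≡_; _≢_; refl; sym; trans; subst; cong)
open import Relation.Nullary using (¬_; Dec; map′; _×-dec_; _⊎-dec_; _→-dec_)
open import Relation.Nullary.Decidable using (toWitness; dec-true)
open import Relation.Unary using (Pred; Decidable)
open import Defs

Move : (G : Graph) → V G → V G → Set
Move G a b = b ≡ a ⊎ adj G a b ≡ true

move? : (G : Graph) (a b : V G) → Dec (Move G a b)
move? G a b = _≟_ G b a ⊎-dec adj G a b Bool.≟ true

dist-refl : (G : Graph) (v : V G) → dist G v v ≡ 0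
dist-refl G v with length (vertices G)
... | zero  = refl
... | suc _ rewrite dec-true (_≟_ G v v) refl = refl

responses : (G : Graph) {k : ℕ} → V G → Vec (V G) k → Vec ℕ k
responses G v B = Vec.map (dist G v) B

Indistinguishable : (G : Graph) {k : ℕ} → Vec (V G) k → V G → V G → Set
Indistinguishable G B a b = responses G a B ≡ responses G b B

Identified : (G : Graph) {k : ℕ} → Vec (V G) k → V G → Set
Identified G B a = ∀ a' → Indistinguishable G B a' a → a' ≡ a

IdentifiedAfterMove : (G : Graph) {k : ℕ} → Vec (V G) k → Vec (V G) k → V G → Set
IdentifiedAfterMove G B₀ B₁ a =
  ∀ a' → Indistinguishable G B₀ a' a →
  ∀ b → Move G a b → ∀ b' → Move G a' b' → Indistinguishable G B₁ b' b → b' ≡ b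

module _ (G : Graph) {k : ℕ} (B₀ : Vec (V G) k) (next : Vec ℕ k → Vec (V G) k) where

  twoProbes : Strategy G k
  twoProbes []      = B₀
  twoProbes (r ∷ _) = next r

  twoProbes-wins :
    (∀ a → Identified G B₀ a ⊎ IdentifiedAfterMove G B₀ (next (responses G a B₀)) a) →
    CopWins G k
  twoProbes-wins identified = twoProbes , located
    where
    located : ∀ w → IsWalk G w → ∃ (Located G twoProbes w)
    located w walk with identified (w 0)
    ... | inj₁ id₀ = 0 , λ w' _ same → id₀ (w' 0) (∷-injectiveˡ same)
    ... | inj₂ id₁ = 1 , λ w' walk' same →
      let same₁ , same₀ = ∷-injective same
          start-same = ∷-injectiveˡ same₀
          probe₁ = next (responses G (w 0) B₀)
      in id₁ (w' 0) start-same (w 1) (walk 0) (w' 1) (walk' 0)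
           (subst (λ r → responses G (w' 1) (next r) ≡ responses G (w 1) probe₁) start-same same₁)

record Evasion (G : Graph) (k : ℕ) (_~_ : V G → V G → Set) : Set where
  field
    ~⇒≢   : ∀ {a b} → a ~ b → a ≢ b
    start : (B : Vec (V G) k) → ∃₂ λ a b → a ~ b × Indistinguishable G B a b
    step  : ∀ {a b} → a ~ b → (B : Vec (V G) k) →
            ∃ λ a' → Move G a a' × ∃ λ b' → Move G b b' × a' ~ b' × Indistinguishable G B a' b'

module Shadowing {G : Graph} {k : ℕ} {_~_ : V G → V G → Set}
                 (ev : Evasion G k _~_) (σ : Strategy G k) where
  open Evasion ev

  Hiding : Vec (V G) k → V G × V G → Set
  Hiding B (a , b) = a ~ b × Indistinguishable G B a b

  Round : Set
  Round = Σ (List (Vec ℕ k)) λ h → Σ (V G × V G) (Hiding (σ h))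

  heardAfter : Round → List (Vec ℕ k)
  heardAfter (h , (a , _) , _) = responses G a (σ h) ∷ h

  -- The Cop is deterministic, so the Robber knows the next probe before moving.
  escape : (r : Round) → let (_ , (a , b) , _) = r in
    ∃ λ a' → Move G a a' × ∃ λ b' → Move G b b' × Hiding (σ (heardAfter r)) (a' , b')
  escape r@(_ , _ , a~b , _) = step a~b (σ (heardAfter r))

  round : ℕ → Round
  round zero    = let a , b , hidden = start (σ []) in [] , (a , b) , hidden
  round (suc t) = let a' , _ , b' , _ , hidden = escape (round t) in
                  heardAfter (round t) , (a' , b') , hidden

  robber shadow : ℕ → V G
  robber t = let _ , (a , _) , _ = round t in a
  shadow t = let _ , (_ , b) , _ = round t in b

  probe : ℕ → Vec (V G) k
  probe t = σ (proj₁ (round t))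

  robber-walk : IsWalk G robber
  robber-walk t = let _ , a→a' , _ = escape (round t) in a→a'

  shadow-walk : IsWalk G shadow
  shadow-walk t = let _ , _ , _ , b→b' , _ = escape (round t) in b→b'

  twins : ∀ t → robber t ~ shadow t
  twins t = let _ , _ , r~s , _ = round t in r~s

  unseparated : ∀ t → Indistinguishable G (probe t) (robber t) (shadow t)
  unseparated t = let _ , _ , _ , same = round t in same

  history-follows : (w : ℕ → V G) →
    (∀ t → responses G (w t) (probe t) ≡ responses G (robber t) (probe t)) →
    ∀ t → history G σ w t ≡ proj₁ (round t)
  history-follows w agree zero    = refl
  history-follows w agree (suc t) rewrite history-follows w agree t =
    cong (_∷ proj₁ (round t)) (agree t)

  shadow-unheard : ∀ t → history G σ shadow t ≡ history G σ robber t
  shadow-unheard t = trans (history-follows shadow (sym ∘ unseparated) t)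
                           (sym (history-follows robber (λ _ → refl) t))

Evasion⇒¬CopWins : ∀ {G k _~_} → Evasion G k _~_ → ¬ CopWins G k
Evasion⇒¬CopWins ev (σ , wins) =
  let t , located = wins robber robber-walk
  in Evasion.~⇒≢ ev (twins t) (sym (located shadow shadow-walk (shadow-unheard (suc t))))
  where open Shadowing ev σ

module _ {m n ℓ} {P : Pred (Fin m × Fin n) ℓ} (P? : Decidable P) where

  all²? : Dec (∀ v → P v)
  all²? = map′ (λ h (i , j) → h i j) (λ h i j → h (i , j)) (all? λ i → all? λ j → P? (i , j))

  any²? : Dec (∃ P)
  any²? = map′ (λ (i , j , p) → (i , j) , p) (λ ((i , j) , p) → i , j , p)
               (any? λ i → any? λ j → P? (i , j))

cycleDist : ℕ → ℕ → ℕ → ℕ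
cycleDist m i j = ∣ i - j ∣ ⊓ (m ∸ ∣ i - j ∣)

torusDist : ∀ {m n} → Fin m × Fin n → Fin m × Fin n → ℕ
torusDist {m} {n} (i , j) (i' , j') = cycleDist m (toℕ i) (toℕ i') + cycleDist n (toℕ j) (toℕ j')

C₅□C₃ : Graph
C₅□C₃ = Cycle 5 □ Cycle 3

-- `dist` is far too slow to evaluate, so the decision procedures below compute with `torusDist`.
dist≡torusDist : ∀ u v → dist C₅□C₃ u v ≡ torusDist u v
dist≡torusDist = toWitness {a? = all²? λ u → all²? λ v → dist C₅□C₃ u v ℕ.≟ torusDist u v} _

responses≡map-torusDist : ∀ v {k} (B : Vec (V C₅□C₃) k) → responses C₅□C₃ v B ≡ Vec.map (torusDist v) B
responses≡map-torusDist v = Vec.map-cong (dist≡torusDist v)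

indistinguishable? : ∀ {k} (B : Vec (V C₅□C₃) k) a b → Dec (Indistinguishable C₅□C₃ B a b)
indistinguishable? B a b =
  map′ (λ e → trans (responses≡map-torusDist a B) (trans e (sym (responses≡map-torusDist b B))))
       (λ e → trans (sym (responses≡map-torusDist a B)) (trans e (responses≡map-torusDist b B)))
       (Vec.≡-dec ℕ._≟_ (Vec.map (torusDist a) B) (Vec.map (torusDist b) B))

Close : V C₅□C₃ → V C₅□C₃ → Set
Close a b = 0 < dist C₅□C₃ a b × dist C₅□C₃ a b ≤ 2

close? : ∀ a b → Dec (Close a b)
close? a b = map′ (subst InRange (sym (dist≡torusDist a b))) (subst InRange (dist≡torusDist a b))
                  (0 <? torusDist a b ×-dec torusDist a b ≤? 2)
  where
  InRange : ℕ → Set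
  InRange d = 0 < d × d ≤ 2

Close⇒≢ : ∀ {a b} → Close a b → a ≢ b
Close⇒≢ {a} (0<d , _) refl = ℕ.<-irrefl (sym (dist-refl C₅□C₃ a)) 0<d

close-start : ∀ x → ∃₂ λ a b → Close a b × Indistinguishable C₅□C₃ (x ∷ []) a b
close-start = toWitness {a? = all²? λ x → any²? λ a → any²? λ b →
  close? a b ×-dec indistinguishable? (x ∷ []) a b} _

close-step : ∀ a b → Close a b → ∀ x → ∃ λ a' → Move C₅□C₃ a a' ×
  ∃ λ b' → Move C₅□C₃ b b' × Close a' b' × Indistinguishable C₅□C₃ (x ∷ []) a' b'
close-step = toWitness {a? = all²? λ a → all²? λ b → close? a b →-dec all²? λ x →
  any²? λ a' → move? C₅□C₃ a a' ×-dec any²? λ b' →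
  move? C₅□C₃ b b' ×-dec close? a' b' ×-dec indistinguishable? (x ∷ []) a' b'} _

closePairsEvade : Evasion C₅□C₃ 1 Close
closePairsEvade = record
  -- Unifying `Close ?a ?b` would unfold `dist` on open terms; passing the implicits avoids it.
  { ~⇒≢   = λ {a} {b} → Close⇒≢ {a} {b}
  ; start = λ { (x ∷ []) → close-start x }
  ; step  = λ {a} {b} a~b → λ { (x ∷ []) → close-step a b a~b x }
  }

firstProbe : Vec (V C₅□C₃) 2
firstProbe = (# 0 , # 0) ∷ (# 0 , # 1) ∷ []

secondProbe : Vec ℕ 2 → Vec (V C₅□C₃) 2
secondProbe (1 ∷ 2 ∷ []) = (# 0 , # 1) ∷ (# 1 , # 2) ∷ []
secondProbe (2 ∷ 1 ∷ []) = (# 0 , # 0) ∷ (# 1 , # 2) ∷ []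
secondProbe (2 ∷ 2 ∷ []) = (# 0 , # 0) ∷ (# 1 , # 1) ∷ []
secondProbe (2 ∷ 3 ∷ []) = (# 1 , # 0) ∷ (# 2 , # 1) ∷ []
secondProbe (3 ∷ 2 ∷ []) = (# 1 , # 0) ∷ (# 2 , # 2) ∷ []
secondProbe (3 ∷ 3 ∷ []) = (# 1 , # 0) ∷ (# 2 , # 1) ∷ []
secondProbe _            = firstProbe

identified? : ∀ {k} (B : Vec (V C₅□C₃) k) a → Dec (Identified C₅□C₃ B a)
identified? B a = all²? λ a' → indistinguishable? B a' a →-dec _≟_ C₅□C₃ a' a

identifiedAfterMove? : ∀ {k} (B₀ B₁ : Vec (V C₅□C₃) k) a → Dec (IdentifiedAfterMove C₅□C₃ B₀ B₁ a)
identifiedAfterMove? B₀ B₁ a =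
  all²? λ a' → indistinguishable? B₀ a' a →-dec
  all²? λ b → move? C₅□C₃ a b →-dec
  all²? λ b' → move? C₅□C₃ a' b' →-dec
  indistinguishable? B₁ b' b →-dec _≟_ C₅□C₃ b' b

twoProbes-identify : ∀ a → Identified C₅□C₃ firstProbe a ⊎
  IdentifiedAfterMove C₅□C₃ firstProbe (secondProbe (Vec.map (torusDist a) firstProbe)) a
twoProbes-identify = toWitness {a? = all²? λ a → identified? firstProbe a ⊎-dec
  identifiedAfterMove? firstProbe (secondProbe (Vec.map (torusDist a) firstProbe)) a} _

twoCopsWin : CopWins C₅□C₃ 2
twoCopsWin = twoProbes-wins C₅□C₃ firstProbe secondProbe identify
  where
  identify : ∀ a → Identified C₅□C₃ firstProbe a ⊎
    IdentifiedAfterMove C₅□C₃ firstProbe (secondProbe (responses C₅□C₃ a firstProbe)) a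
  identify a = subst (λ r → Identified C₅□C₃ firstProbe a ⊎
                             IdentifiedAfterMove C₅□C₃ firstProbe (secondProbe r) a)
                     (sym (responses≡map-torusDist a firstProbe)) (twoProbes-identify a)

fewerCopsLose : ∀ j → 1 ≤ j → j < 2 → ¬ CopWins C₅□C₃ j
fewerCopsLose (suc zero)    _ _              = Evasion⇒¬CopWins closePairsEvade
fewerCopsLose (suc (suc _)) _ (s≤s (s≤s ()))

proposition5p12 : LocalizationNumberIs (Cycle 5 □ Cycle 3) 2
proposition5p12 = s≤s z≤n , twoCopsWin , fewerCopsLose
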